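{- Let $v\equiv 7,15\pmod{20}$. Consider any decomposition of the edge set of $K_v$ into copies of $K_3$, $K_4$ and $K_5$ with exactly $\frac{v^2+3v+10}{20}$ cliques in total, of which exactly $5$ are copies of $K_3$. Then these five triangles are pairwise vertex-disjoint.
   Context: A decomposition of the edge set of $K_v$ into cliques means a collection of complete subgraphs of $K_v$ such that every edge of $K_v$ lies in exactly one of them. -}

module Defs where

open import Data.Nat using (ℕ; _+_; _*_; _%_)
open import Data.Fin using (Fin)
open import Data.Fin.Properties using () renaming (_≟_ to _≟ᶠ_)
open import Data.List using (List; length; filter; lookup)
open import Data.List.Relation.Unary.Unique.Propositional using (Unique)
open import Data.List.Membership.Propositional using (_∈_)
import Data.List.Membership.DecPropositional as DecMem
open import Data.Product using (_×_)
open import Data.Sum using (_⊎_)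
open import Relation.Binary.PropositionalEquality using (_≡_; _≢_)
open import Relation.Nullary.Decidable using (_×-dec_)
open import Data.Empty using (⊥)

-- A block (clique) of K_v on vertex set Fin v is given by its vertex list.
Block : ℕ → Set
Block v = List (Fin v)

IsK345 : ∀ {v} → Block v → Set
IsK345 b = Unique b × (length b ≡ 3 ⊎ length b ≡ 4 ⊎ length b ≡ 5)

edgeCount : ∀ {v} → List (Block v) → Fin v → Fin v → ℕ
edgeCount {v} B x y = length (filter (λ b → (x ∈? b) ×-dec (y ∈? b)) B)
  where open DecMem (_≟ᶠ_ {v}) using (_∈?_)

record IsK345Decomposition {v : ℕ} (B : List (Block v)) : Set where
  field
    blocks-ok : ∀ (i : Fin (length B)) → IsK345 (lookup B i)
    exact     : ∀ (x y : Fin v) → x ≢ y → edgeCount B x y ≡ 1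

numTriangles : ∀ {v} → List (Block v) → ℕ
numTriangles B = length (filter (λ b → length b Data.Nat.≟ 3) B)
  where import Data.Nat

VertexDisjoint : ∀ {v} → Block v → Block v → Set
VertexDisjoint b c = ∀ x → x ∈ b → x ∈ c → ⊥

-- Let a_x, b_x, c_x count the triangles, K_4's and K_5's through a vertex x. The
-- edges at x are split among these blocks, so 2a_x + 3b_x + 4c_x = v - 1, and as
-- v ≡ 3 (mod 4) this forces 2a_x + b_x ≥ 2. Summing over all vertices gives
-- 6n_3 + 4n_4 ≥ 2v, strictly if some vertex lies on two triangles. But counting
-- edges and blocks with n_3 = 5 and n_3 + n_4 + n_5 = (v² + 3v + 10)/20 yields
-- v = 15 + 2n_4, i.e. 6n_3 + 4n_4 = 2v exactly.
module Submission where

open import Defs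
open import Data.Nat using (ℕ; _+_; _*_; _%_)
open import Data.Fin using (Fin)
open import Data.List using (List; length; lookup)
open import Data.Sum using (_⊎_)
open import Relation.Binary.PropositionalEquality using (_≡_; _≢_)

open import Level using (Level)
open import Data.Bool using (true; false; if_then_else_)
open import Data.Empty using (⊥-elim)
open import Data.Fin using (zero; suc; punchIn; punchOut)
open import Data.Fin.Properties using (punchInᵢ≢i; punchIn-punchOut) renaming (_≟_ to _≟ᶠ_)
open import Data.List using ([]; _∷_; filter)
open import Data.List.Membership.Propositional using (_∈_; _∉_)
import Data.List.Membership.DecPropositional as DecMembership
open import Data.List.Relation.Unary.All.Properties using (All¬⇒¬Any)
open import Data.List.Relation.Unary.AllPairs using (_∷_)
open import Data.List.Relation.Unary.Unique.Propositional using (Unique)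
open import Data.Nat using (zero; suc; _≤_; _≟_; s≤s; z≤n)
open import Data.Nat.DivMod using (m∣n⇒o%n%m≡o%m; [m+kn]%n≡m%n)
open import Data.Nat.Divisibility using (divides-refl)
open import Data.Nat.Properties
open import Data.Nat.Tactic.RingSolver using (solve-∀; solve)
open import Data.Product using (proj₁; proj₂)
open import Data.Sum using (inj₁; inj₂)
open import Relation.Nullary using (Dec; yes; no; does; ¬_; contradiction)
open import Relation.Nullary.Decidable using (_×-dec_)
open import Relation.Unary using (Pred; Decidable)
open import Relation.Binary.PropositionalEquality using (refl; sym; trans; cong; cong₂; subst; module ≡-Reasoning)

open import Algebra.Properties.Semiring.Sum +-*-semiring
  using (sum; sum-syntax; sum-cong-≗; sum-remove; sum-replicate-zero; ∑-distrib-+; ∑-comm; *-distribˡ-sum; *-distribʳ-sum)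

private
  variable
    a p q : Level
    A : Set a
    P : Set p
    Q : Set q
    k m n s : ℕ

𝟙 : Dec P → ℕ
𝟙 d = if does d then 1 else 0

𝟙-≡1 : (d : Dec P) → P → 𝟙 d ≡ 1
𝟙-≡1 (yes _) _  = refl
𝟙-≡1 (no ¬p) p = ⊥-elim (¬p p)

𝟙-≡0 : (d : Dec P) → ¬ P → 𝟙 d ≡ 0
𝟙-≡0 (yes p) ¬p = ⊥-elim (¬p p)
𝟙-≡0 (no _)  _  = refl

𝟙-×-dec : (d : Dec P) (e : Dec Q) → 𝟙 (d ×-dec e) ≡ 𝟙 d * 𝟙 e
𝟙-×-dec (yes _) (yes _) = refl
𝟙-×-dec (yes _) (no _)  = refl
𝟙-×-dec (no _)  _       = refl

𝟙-idem : (d : Dec P) → 𝟙 d * 𝟙 d ≡ 𝟙 d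
𝟙-idem (yes _) = refl
𝟙-idem (no _)  = refl

∑-const : ∀ n c → ∑[ i < n ] c ≡ n * c
∑-const zero    c = refl
∑-const (suc n) c = cong (c +_) (∑-const n c)

∑-off-point : ∀ {c} (f : Fin n → ℕ) (x : Fin n) →
              (∀ y → y ≢ x → f y ≡ c) → sum f + c ≡ f x + n * c
∑-off-point {suc n} {c} f x f≡c = begin
  sum f + c                          ≡⟨ cong (_+ c) (sum-remove {i = x} f) ⟩
  f x + sum (λ j → f (punchIn x j)) + c
    ≡⟨ cong (λ t → f x + t + c) (sum-cong-≗ (λ j → f≡c (punchIn x j) (punchInᵢ≢i x j))) ⟩
  f x + ∑[ j < n ] c + c             ≡⟨ cong (λ t → f x + t + c) (∑-const n c) ⟩
  f x + n * c + c                    ≡⟨ +-assoc (f x) (n * c) c ⟩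
  f x + (n * c + c)                  ≡⟨ cong (f x +_) (+-comm (n * c) c) ⟩
  f x + suc n * c                    ∎
  where open ≡-Reasoning

∑-≥-term : (f : Fin n → ℕ) (i : Fin n) → f i ≤ sum f
∑-≥-term {suc n} f i = subst (f i ≤_) (sym (sum-remove {i = i} f)) (m≤m+n (f i) _)

∑-≥-pair : (f : Fin n → ℕ) {i j : Fin n} → i ≢ j → f i + f j ≤ sum f
∑-≥-pair {suc n} f {i} {j} i≢j = begin
  f i + f j                           ≡⟨ cong (λ t → f i + f t) (punchIn-punchOut i≢j) ⟨
  f i + f (punchIn i (punchOut i≢j))  ≤⟨ +-monoʳ-≤ (f i) (∑-≥-term (λ t → f (punchIn i t)) _) ⟩
  f i + sum (λ t → f (punchIn i t))   ≡⟨ sum-remove f ⟨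
  sum f                               ∎
  where open ≤-Reasoning

∑-≥-const : (f : Fin n → ℕ) → (∀ y → k ≤ f y) → n * k ≤ sum f
∑-≥-const {zero}  f k≤f = z≤n
∑-≥-const {suc n} f k≤f = +-mono-≤ (k≤f zero) (∑-≥-const (λ i → f (suc i)) (λ i → k≤f (suc i)))

∑-≥-excess : ∀ {e} (f : Fin n → ℕ) (x : Fin n) →
                   (∀ y → k ≤ f y) → k + e ≤ f x → e + n * k ≤ sum f
∑-≥-excess {suc n} {k} {e} f x k≤f k+e≤fx = begin
  e + (k + n * k)                    ≡⟨ solve (e ∷ k ∷ n ∷ []) ⟩
  k + e + n * k                      ≤⟨ +-mono-≤ k+e≤fx (∑-≥-const (λ j → f (punchIn x j)) (λ j → k≤f (punchIn x j))) ⟩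
  f x + sum (λ j → f (punchIn x j))  ≡⟨ sum-remove f ⟨
  sum f                              ∎
  where open ≤-Reasoning

length-filter-∑ : {P : Pred A p} (P? : Decidable P) (xs : List A) →
                  length (filter P? xs) ≡ ∑[ i < length xs ] 𝟙 (P? (lookup xs i))
length-filter-∑ P? []       = refl
length-filter-∑ P? (x ∷ xs) with does (P? x)
... | true  = cong suc (length-filter-∑ P? xs)
... | false = length-filter-∑ P? xs

module _ {v : ℕ} where
  open DecMembership (_≟ᶠ_ {v}) using (_∈?_)

  [_∈_] : Fin v → Block v → ℕ
  [ x ∈ b ] = 𝟙 (x ∈? b)

  [∈]-∷ : ∀ (x a : Fin v) (b : Block v) → a ∉ b → [ x ∈ a ∷ b ] ≡ 𝟙 (x ≟ᶠ a) + [ x ∈ b ]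
  [∈]-∷ x a b a∉b with x ≟ᶠ a
  ... | yes refl = cong suc (sym (𝟙-≡0 (x ∈? b) a∉b))
  ... | no _     = refl

  ∑-[≟] : (a : Fin v) → ∑[ x < v ] 𝟙 (x ≟ᶠ a) ≡ 1
  ∑-[≟] a = begin
    ∑[ x < v ] 𝟙 (x ≟ᶠ a)      ≡⟨ +-identityʳ _ ⟨
    ∑[ x < v ] 𝟙 (x ≟ᶠ a) + 0  ≡⟨ ∑-off-point (λ x → 𝟙 (x ≟ᶠ a)) a (λ y y≢a → 𝟙-≡0 (y ≟ᶠ a) y≢a) ⟩
    𝟙 (a ≟ᶠ a) + v * 0         ≡⟨ cong₂ _+_ (𝟙-≡1 (a ≟ᶠ a) refl) (*-zeroʳ v) ⟩
    1                          ∎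
    where open ≡-Reasoning

  ∑-[∈] : (b : Block v) → Unique b → ∑[ x < v ] [ x ∈ b ] ≡ length b
  ∑-[∈] []      _              = sum-replicate-zero v
  ∑-[∈] (a ∷ b) (a∉b ∷ unique) = begin
    ∑[ x < v ] [ x ∈ a ∷ b ]                       ≡⟨ sum-cong-≗ (λ x → [∈]-∷ x a b (All¬⇒¬Any a∉b)) ⟩
    ∑[ x < v ] (𝟙 (x ≟ᶠ a) + [ x ∈ b ])            ≡⟨ ∑-distrib-+ (λ x → 𝟙 (x ≟ᶠ a)) (λ x → [ x ∈ b ]) ⟩
    ∑[ x < v ] 𝟙 (x ≟ᶠ a) + ∑[ x < v ] [ x ∈ b ]  ≡⟨ cong₂ _+_ (∑-[≟] a) (∑-[∈] b unique) ⟩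
    suc (length b)                                 ∎
    where open ≡-Reasoning

∑-+₃ : (f g h : Fin n → ℕ) → ∑[ i < n ] (f i + g i + h i) ≡ sum f + sum g + sum h
∑-+₃ f g h = trans (∑-distrib-+ (λ i → f i + g i) h) (cong (_+ sum h) (∑-distrib-+ f g))

∑-linear₃ : ∀ a b c (f g h : Fin n → ℕ) →
            ∑[ i < n ] (a * f i + b * g i + c * h i) ≡ a * sum f + b * sum g + c * sum h
∑-linear₃ a b c f g h = trans (∑-+₃ (λ i → a * f i) (λ i → b * g i) (λ i → c * h i))
  (sym (cong₂ _+_ (cong₂ _+_ (*-distribˡ-sum a f) (*-distribˡ-sum b g)) (*-distribˡ-sum c h)))

Size345 : ℕ → Set
Size345 s = s ≡ 3 ⊎ s ≡ 4 ⊎ s ≡ 5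

size-partition : Size345 s → 𝟙 (s ≟ 3) + 𝟙 (s ≟ 4) + 𝟙 (s ≟ 5) ≡ 1
size-partition (inj₁ refl)        = refl
size-partition (inj₂ (inj₁ refl)) = refl
size-partition (inj₂ (inj₂ refl)) = refl

size-expansion : Size345 s → s ≡ 3 * 𝟙 (s ≟ 3) + 4 * 𝟙 (s ≟ 4) + 5 * 𝟙 (s ≟ 5)
size-expansion (inj₁ refl)        = refl
size-expansion (inj₂ (inj₁ refl)) = refl
size-expansion (inj₂ (inj₂ refl)) = refl

*-size-partition : ∀ m → Size345 s → m ≡ m * 𝟙 (s ≟ 3) + m * 𝟙 (s ≟ 4) + m * 𝟙 (s ≟ 5)
*-size-partition m size = trans (sym (*-identityʳ m)) (trans (cong (m *_) (sym (size-partition size))) (distrib m _ _ _))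
  where
  distrib : ∀ m a b c → m * (a + b + c) ≡ m * a + m * b + m * c
  distrib = solve-∀

*-size-expansion : ∀ m → Size345 s →
                   m * s ≡ 3 * (m * 𝟙 (s ≟ 3)) + 4 * (m * 𝟙 (s ≟ 4)) + 5 * (m * 𝟙 (s ≟ 5))
*-size-expansion m size = trans (cong (m *_) (size-expansion size)) (distrib m _ _ _)
  where
  distrib : ∀ m a b c → m * (3 * a + 4 * b + 5 * c) ≡ 3 * (m * a) + 4 * (m * b) + 5 * (m * c)
  distrib = solve-∀

size-indicator : ∀ s k → s * 𝟙 (s ≟ k) ≡ k * 𝟙 (s ≟ k)
size-indicator s k = go (s ≟ k)
  where
  go : (d : Dec (s ≡ k)) → s * 𝟙 d ≡ k * 𝟙 d
  go (yes refl) = refl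
  go (no _)     = trans (*-zeroʳ s) (sym (*-zeroʳ k))

2≤2*a+b : ∀ a b c → 2 * a + 3 * b + 4 * c + 1 ≡ m → m % 4 ≡ 3 → 2 ≤ 2 * a + b
2≤2*a+b (suc a)        b c _ _ = ≤-trans (*-monoʳ-≤ 2 (s≤s z≤n)) (m≤m+n (2 * suc a) b)
2≤2*a+b zero (suc (suc b)) c _ _ = s≤s (s≤s z≤n)
2≤2*a+b zero zero          c refl m%4≡3 =
  contradiction (trans (sym m%4≡3) (trans (cong (_% 4) (rearrange c)) ([m+kn]%n≡m%n 1 c 4))) λ ()
  where
  rearrange : ∀ c → 2 * 0 + 3 * 0 + 4 * c + 1 ≡ 1 + c * 4
  rearrange = solve-∀
2≤2*a+b zero (suc zero)    c refl m%4≡3 =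
  contradiction (trans (sym m%4≡3) (trans (cong (_% 4) (rearrange c)) ([m+kn]%n≡m%n 0 (suc c) 4))) λ ()
  where
  rearrange : ∀ c → 2 * 0 + 3 * 1 + 4 * c + 1 ≡ 0 + suc c * 4
  rearrange = solve-∀

v%4≡3 : ∀ v → v % 20 ≡ 7 ⊎ v % 20 ≡ 15 → v % 4 ≡ 3
v%4≡3 v (inj₁ v%20≡7)  = trans (sym (m∣n⇒o%n%m≡o%m 4 20 v (divides-refl 5))) (cong (_% 4) v%20≡7)
v%4≡3 v (inj₂ v%20≡15) = trans (sym (m∣n⇒o%n%m≡o%m 4 20 v (divides-refl 5))) (cong (_% 4) v%20≡15)

-- Subtracting the first equation from the second leaves 4v = 60 + 8n₄.
counts⇒v≡15+2n₄ : ∀ v n₃ n₄ n₅ → n₃ ≡ 5 → 2 * (3 * n₃) + 3 * (4 * n₄) + 4 * (5 * n₅) + v * 1 ≡ v * v →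
                  20 * (n₃ + n₄ + n₅) ≡ v * v + 3 * v + 10 → v ≡ 15 + 2 * n₄
counts⇒v≡15+2n₄ v n₃ n₄ n₅ refl ∑deg blocks = *-cancelˡ-≡ v (15 + 2 * n₄) 4 (+-cancelˡ-≡ (40 + 12 * n₄ + 20 * n₅) _ _ (begin
  40 + 12 * n₄ + 20 * n₅ + 4 * v                                           ≡⟨ solve (v ∷ n₄ ∷ n₅ ∷ []) ⟩
  2 * (3 * 5) + 3 * (4 * n₄) + 4 * (5 * n₅) + v * 1 + 3 * v + 10           ≡⟨ cong (λ t → t + 3 * v + 10) ∑deg ⟩
  v * v + 3 * v + 10                                                       ≡⟨ blocks ⟨
  20 * (5 + n₄ + n₅)                                                       ≡⟨ solve (n₄ ∷ n₅ ∷ []) ⟩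
  40 + 12 * n₄ + 20 * n₅ + 4 * (15 + 2 * n₄)                               ∎))
  where open ≡-Reasoning

no-excess : ∀ v n₃ n₄ → n₃ ≡ 5 → v ≡ 15 + 2 * n₄ → ¬ (2 + v * 2 ≤ 2 * (3 * n₃) + 4 * n₄)
no-excess v n₃ n₄ refl refl excess = 1+n≰n (≤-trans (n≤1+n _) (subst (2 + v * 2 ≤_) (rearrange n₄) excess))
  where
  rearrange : ∀ n₄ → 2 * (3 * 5) + 4 * n₄ ≡ (15 + 2 * n₄) * 2
  rearrange = solve-∀

module Incidence {v n : ℕ} (bs : Fin n → Block v) where
  open DecMembership (_≟ᶠ_ {v}) using (_∈?_)

  pairCount : Fin v → Fin v → ℕ
  pairCount x y = ∑[ i < n ] ([ x ∈ bs i ] * [ y ∈ bs i ])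

  hasSize : ℕ → Fin n → ℕ
  hasSize k i = 𝟙 (length (bs i) ≟ k)

  incidentOfSize : ℕ → Fin v → Fin n → ℕ
  incidentOfSize k x i = [ x ∈ bs i ] * hasSize k i

  blocksThrough : ℕ → Fin v → ℕ
  blocksThrough k x = sum (incidentOfSize k x)

  blocksOfSize : ℕ → ℕ
  blocksOfSize k = sum (hasSize k)

  handshake : (∀ i → Unique (bs i)) → (g : Fin n → ℕ) →
              ∑[ x < v ] ∑[ i < n ] ([ x ∈ bs i ] * g i) ≡ ∑[ i < n ] (length (bs i) * g i)
  handshake unique g = begin
    ∑[ x < v ] ∑[ i < n ] ([ x ∈ bs i ] * g i)  ≡⟨ ∑-comm (λ x i → [ x ∈ bs i ] * g i) ⟩
    ∑[ i < n ] ∑[ x < v ] ([ x ∈ bs i ] * g i)  ≡⟨ sum-cong-≗ (λ i → *-distribʳ-sum (g i) (λ x → [ x ∈ bs i ])) ⟨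
    ∑[ i < n ] (∑[ x < v ] [ x ∈ bs i ] * g i)  ≡⟨ sum-cong-≗ (λ i → cong (_* g i) (∑-[∈] (bs i) (unique i))) ⟩
    ∑[ i < n ] (length (bs i) * g i)            ∎
    where open ≡-Reasoning

  -- Both sides count the pairs (y, block through x and y): y = x contributes one
  -- per block through x, and each of the other v - 1 vertices exactly one.
  replication-identity : (∀ i → Unique (bs i)) → (∀ x y → x ≢ y → pairCount x y ≡ 1) → ∀ x →
                         ∑[ i < n ] ([ x ∈ bs i ] * length (bs i)) + 1 ≡ ∑[ i < n ] [ x ∈ bs i ] + v
  replication-identity unique exact x = begin
    ∑[ i < n ] ([ x ∈ bs i ] * length (bs i)) + 1  ≡⟨ cong (_+ 1) (sum-cong-≗ (λ i → *-comm [ x ∈ bs i ] _)) ⟩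
    ∑[ i < n ] (length (bs i) * [ x ∈ bs i ]) + 1  ≡⟨ cong (_+ 1) (handshake unique (λ i → [ x ∈ bs i ])) ⟨
    ∑[ y < v ] pairCount y x + 1                   ≡⟨ ∑-off-point {n = v} (λ y → pairCount y x) x (λ y y≢x → exact y x y≢x) ⟩
    pairCount x x + v * 1                          ≡⟨ cong₂ _+_ (sum-cong-≗ (λ i → 𝟙-idem (x ∈? bs i))) (*-identityʳ v) ⟩
    ∑[ i < n ] [ x ∈ bs i ] + v                    ∎
    where open ≡-Reasoning

  ∑-blocksThrough : (∀ i → Unique (bs i)) → ∀ k → ∑[ x < v ] blocksThrough k x ≡ k * blocksOfSize k
  ∑-blocksThrough unique k = begin
    ∑[ x < v ] blocksThrough k x              ≡⟨ handshake unique (hasSize k) ⟩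
    ∑[ i < n ] (length (bs i) * hasSize k i)  ≡⟨ sum-cong-≗ (λ i → size-indicator (length (bs i)) k) ⟩
    ∑[ i < n ] (k * hasSize k i)              ≡⟨ *-distribˡ-sum k (hasSize k) ⟨
    k * blocksOfSize k                        ∎
    where open ≡-Reasoning

  2≤blocksThrough : ∀ {k i j x} → i ≢ j → x ∈ bs i → x ∈ bs j →
                    length (bs i) ≡ k → length (bs j) ≡ k → 2 ≤ blocksThrough k x
  2≤blocksThrough {k} {i} {j} {x} i≢j x∈bᵢ x∈bⱼ |bᵢ|≡k |bⱼ|≡k =
    subst (_≤ blocksThrough k x) (cong₂ _+_ (incident x∈bᵢ |bᵢ|≡k) (incident x∈bⱼ |bⱼ|≡k))
          (∑-≥-pair (incidentOfSize k x) i≢j)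
    where
    incident : ∀ {l} → x ∈ bs l → length (bs l) ≡ k → incidentOfSize k x l ≡ 1
    incident {l} x∈bₗ |bₗ|≡k = cong₂ _*_ (𝟙-≡1 (x ∈? bs l) x∈bₗ) (𝟙-≡1 (length (bs l) ≟ k) |bₗ|≡k)

  weight : Fin v → ℕ
  weight x = 2 * blocksThrough 3 x + blocksThrough 4 x

  ∑-weight : (∀ i → Unique (bs i)) → sum weight ≡ 2 * (3 * blocksOfSize 3) + 4 * blocksOfSize 4
  ∑-weight unique = begin
    sum weight                                                  ≡⟨ ∑-distrib-+ (λ x → 2 * blocksThrough 3 x) (blocksThrough 4) ⟩
    ∑[ x < v ] (2 * blocksThrough 3 x) + sum (blocksThrough 4)  ≡⟨ cong (_+ sum (blocksThrough 4)) (*-distribˡ-sum 2 (blocksThrough 3)) ⟨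
    2 * sum (blocksThrough 3) + sum (blocksThrough 4)           ≡⟨ cong₂ _+_ (cong (2 *_) (∑-blocksThrough unique 3)) (∑-blocksThrough unique 4) ⟩
    2 * (3 * blocksOfSize 3) + 4 * blocksOfSize 4               ∎
    where open ≡-Reasoning

  module _ (size : ∀ i → Size345 (length (bs i))) where

    count-by-size : n ≡ blocksOfSize 3 + blocksOfSize 4 + blocksOfSize 5
    count-by-size = begin
      n                                                     ≡⟨ *-identityʳ n ⟨
      n * 1                                                 ≡⟨ ∑-const n 1 ⟨
      ∑[ i < n ] 1                                          ≡⟨ sum-cong-≗ (λ i → sym (size-partition (size i))) ⟩
      ∑[ i < n ] (hasSize 3 i + hasSize 4 i + hasSize 5 i)  ≡⟨ ∑-+₃ (hasSize 3) (hasSize 4) (hasSize 5) ⟩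
      blocksOfSize 3 + blocksOfSize 4 + blocksOfSize 5      ∎
      where open ≡-Reasoning

    ∑-[∈]-by-size : ∀ x → ∑[ i < n ] [ x ∈ bs i ] ≡ blocksThrough 3 x + blocksThrough 4 x + blocksThrough 5 x
    ∑-[∈]-by-size x = trans (sum-cong-≗ (λ i → *-size-partition [ x ∈ bs i ] (size i)))
                            (∑-+₃ (incidentOfSize 3 x) (incidentOfSize 4 x) (incidentOfSize 5 x))

    ∑-[∈]*length-by-size : ∀ x → ∑[ i < n ] ([ x ∈ bs i ] * length (bs i)) ≡
                           3 * blocksThrough 3 x + 4 * blocksThrough 4 x + 5 * blocksThrough 5 x
    ∑-[∈]*length-by-size x = trans (sum-cong-≗ (λ i → *-size-expansion [ x ∈ bs i ] (size i)))
                                   (∑-linear₃ 3 4 5 (incidentOfSize 3 x) (incidentOfSize 4 x) (incidentOfSize 5 x))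

    module _ (unique : ∀ i → Unique (bs i)) (exact : ∀ x y → x ≢ y → pairCount x y ≡ 1) where

      vertex-equation : ∀ x → 2 * blocksThrough 3 x + 3 * blocksThrough 4 x + 4 * blocksThrough 5 x + 1 ≡ v
      vertex-equation x = +-cancelˡ-≡ (r₃ + r₄ + r₅) _ _ (begin
        r₃ + r₄ + r₅ + (2 * r₃ + 3 * r₄ + 4 * r₅ + 1)      ≡⟨ rearrange r₃ r₄ r₅ ⟩
        3 * r₃ + 4 * r₄ + 5 * r₅ + 1                       ≡⟨ cong (_+ 1) (∑-[∈]*length-by-size x) ⟨
        ∑[ i < n ] ([ x ∈ bs i ] * length (bs i)) + 1      ≡⟨ replication-identity unique exact x ⟩
        ∑[ i < n ] [ x ∈ bs i ] + v                        ≡⟨ cong (_+ v) (∑-[∈]-by-size x) ⟩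
        r₃ + r₄ + r₅ + v                                   ∎)
        where
        open ≡-Reasoning
        r₃ = blocksThrough 3 x
        r₄ = blocksThrough 4 x
        r₅ = blocksThrough 5 x
        rearrange : ∀ a b c → a + b + c + (2 * a + 3 * b + 4 * c + 1) ≡ 3 * a + 4 * b + 5 * c + 1
        rearrange = solve-∀

      ∑-vertex-equation : 2 * (3 * blocksOfSize 3) + 3 * (4 * blocksOfSize 4) + 4 * (5 * blocksOfSize 5) + v * 1 ≡ v * v
      ∑-vertex-equation = begin
        2 * (3 * blocksOfSize 3) + 3 * (4 * blocksOfSize 4) + 4 * (5 * blocksOfSize 5) + v * 1
          ≡⟨ cong₂ _+_ (cong₂ _+_ (cong₂ _+_ (cong (2 *_) (∑-blocksThrough unique 3))
                                             (cong (3 *_) (∑-blocksThrough unique 4)))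
                                  (cong (4 *_) (∑-blocksThrough unique 5)))
                       (∑-const v 1) ⟨
        2 * sum (blocksThrough 3) + 3 * sum (blocksThrough 4) + 4 * sum (blocksThrough 5) + ∑[ x < v ] 1
          ≡⟨ cong (_+ ∑[ x < v ] 1) (∑-linear₃ 2 3 4 (blocksThrough 3) (blocksThrough 4) (blocksThrough 5)) ⟨
        ∑[ x < v ] (2 * blocksThrough 3 x + 3 * blocksThrough 4 x + 4 * blocksThrough 5 x) + ∑[ x < v ] 1
          ≡⟨ ∑-distrib-+ (λ x → 2 * blocksThrough 3 x + 3 * blocksThrough 4 x + 4 * blocksThrough 5 x) (λ _ → 1) ⟨
        ∑[ x < v ] (2 * blocksThrough 3 x + 3 * blocksThrough 4 x + 4 * blocksThrough 5 x + 1)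
          ≡⟨ sum-cong-≗ vertex-equation ⟩
        ∑[ x < v ] v
          ≡⟨ ∑-const v v ⟩
        v * v ∎
        where open ≡-Reasoning

      2≤weight : v % 4 ≡ 3 → ∀ x → 2 ≤ weight x
      2≤weight v%4≡3 x =
        2≤2*a+b (blocksThrough 3 x) (blocksThrough 4 x) (blocksThrough 5 x) (vertex-equation x) v%4≡3

      v≡15+2n₄ : blocksOfSize 3 ≡ 5 → 20 * n ≡ v * v + 3 * v + 10 → v ≡ 15 + 2 * blocksOfSize 4
      v≡15+2n₄ n₃≡5 20n≡ = counts⇒v≡15+2n₄ v (blocksOfSize 3) (blocksOfSize 4) (blocksOfSize 5) n₃≡5
        ∑-vertex-equation (trans (cong (20 *_) (sym count-by-size)) 20n≡)

edgeCount≡pairCount : ∀ {v} (B : List (Block v)) x y → edgeCount B x y ≡ Incidence.pairCount (lookup B) x y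
edgeCount≡pairCount {v} B x y =
  trans (length-filter-∑ (λ b → (x ∈? b) ×-dec (y ∈? b)) B) (sum-cong-≗ (λ i → 𝟙-×-dec (x ∈? lookup B i) (y ∈? lookup B i)))
  where open DecMembership (_≟ᶠ_ {v}) using (_∈?_)

proposition9 : (v : ℕ) → (v % 20 ≡ 7 ⊎ v % 20 ≡ 15) →
    (B : List (Block v)) → IsK345Decomposition B →
    20 * length B ≡ v * v + 3 * v + 10 →
    numTriangles B ≡ 5 →
    ∀ (i j : Fin (length B)) → i ≢ j →
    length (lookup B i) ≡ 3 → length (lookup B j) ≡ 3 →
    VertexDisjoint (lookup B i) (lookup B j)
proposition9 v v%20 B D 20|B| #triangles i j i≢j |bᵢ|≡3 |bⱼ|≡3 x x∈bᵢ x∈bⱼ =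
  no-excess v (blocksOfSize 3) (blocksOfSize 4) n₃≡5 (v≡15+2n₄ size unique pairCount≡1 n₃≡5 20|B|) (begin
    2 + v * 2                                      ≤⟨ ∑-≥-excess weight x (2≤weight size unique pairCount≡1 (v%4≡3 v v%20)) weight-x ⟩
    sum weight                                     ≡⟨ ∑-weight unique ⟩
    2 * (3 * blocksOfSize 3) + 4 * blocksOfSize 4  ∎)
  where
  open IsK345Decomposition D
  open Incidence (lookup B)
  open ≤-Reasoning

  unique : ∀ i → Unique (lookup B i)
  unique i = proj₁ (blocks-ok i)

  size : ∀ i → Size345 (length (lookup B i))
  size i = proj₂ (blocks-ok i)

  pairCount≡1 : ∀ x y → x ≢ y → pairCount x y ≡ 1
  pairCount≡1 x y x≢y = trans (sym (edgeCount≡pairCount B x y)) (exact x y x≢y)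

  n₃≡5 : blocksOfSize 3 ≡ 5
  n₃≡5 = trans (sym (length-filter-∑ (λ b → length b ≟ 3) B)) #triangles

  weight-x : 2 + 2 ≤ weight x
  weight-x = ≤-trans (*-monoʳ-≤ 2 (2≤blocksThrough i≢j x∈bᵢ x∈bⱼ |bᵢ|≡3 |bⱼ|≡3)) (m≤m+n _ _)
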